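{- Let $D$ be a finite homomorphism-homogeneous reflexive bidirectionally disconnected improper digraph with back-and-forth. Then for all $S,T\in V(D)/\theta(D)$, $S\sim T$ implies $S\rightleftarrows T$.
   Context: Digraph $D=(V,E)$, $V$ finite; $x\to y$ means $(x,y)\in E$, $x\rightleftarrows y$ means both directions. Reflexive: all loops; improper: $E$ neither symmetric nor antisymmetric. For nonempty $X,Y\subseteq V$: $X\to Y$ means some $x\in X,y\in Y$ with $x\to y$; $X\sim Y$: $X\to Y$ or $Y\to X$; $X\rightleftarrows Y$: $X\to Y$ and $Y\to X$. Homomorphism-homogeneous: every homomorphism $D[U]\to D[W]$ between induced subdigraphs ($U,W$ nonempty) extends to an endomorphism. $\omega(D)$: number of weak components; $(x,y)\in\theta(D)$ iff $x=y$ or $x=z_1\rightleftarrows\cdots\rightleftarrows z_k=y$; bidirectionally disconnected: $\omega(D)<|V/\theta(D)|$. With back-and-forth: there exist distinct $S,T\in V/\theta(D)$ with $S\rightleftarrows T$. -}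

module Defs where

open import Data.Nat using (ℕ; _<_)
open import Data.Fin using (Fin)
open import Data.Fin.Subset using (Subset; _∈_; Nonempty)
open import Data.Bool using (Bool; T)
open import Data.Product using (Σ; ∃; _×_; _,_)
open import Data.Sum using (_⊎_)
open import Relation.Nullary using (¬_)
open import Relation.Binary.PropositionalEquality using (_≡_)
open import Relation.Binary.Construct.Closure.ReflexiveTransitive using (Star)
open import Function.Definitions using (Surjective)

record Digraph : Set where
  field
    n   : ℕ
    adj : Fin n → Fin n → Bool

open Digraph public

Edge : (D : Digraph) → Fin (n D) → Fin (n D) → Set
Edge D x y = T (adj D x y)

Bi : (D : Digraph) → Fin (n D) → Fin (n D) → Set
Bi D x y = Edge D x y × Edge D y x

Reflexive : Digraph → Set
Reflexive D = ∀ x → Edge D x x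

SymmetricD : Digraph → Set
SymmetricD D = ∀ x y → Edge D x y → Edge D y x

AntisymmetricD : Digraph → Set
AntisymmetricD D = ∀ x y → Edge D x y → Edge D y x → x ≡ y

Improper : Digraph → Set
Improper D = ¬ SymmetricD D × ¬ AntisymmetricD D

IsEndo : (D : Digraph) → (Fin (n D) → Fin (n D)) → Set
IsEndo D g = ∀ x y → Edge D x y → Edge D (g x) (g y)

IsHomInduced : (D : Digraph) → Subset (n D) → Subset (n D) → (Fin (n D) → Fin (n D)) → Set
IsHomInduced D U W f =
  (∀ x → x ∈ U → f x ∈ W) ×
  (∀ x y → x ∈ U → y ∈ U → Edge D x y → Edge D (f x) (f y))

HomHomogeneous : Digraph → Set
HomHomogeneous D =
  ∀ (U W : Subset (n D)) → Nonempty U → Nonempty W →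
  ∀ (f : Fin (n D) → Fin (n D)) → IsHomInduced D U W f →
  ∃ λ (g : Fin (n D) → Fin (n D)) → IsEndo D g × (∀ x → x ∈ U → g x ≡ f x)

θ : (D : Digraph) → Fin (n D) → Fin (n D) → Set
θ D = Star (Bi D)

WeakConn : (D : Digraph) → Fin (n D) → Fin (n D) → Set
WeakConn D = Star (λ x y → Edge D x y ⊎ Edge D y x)

-- R (an equivalence on Fin m) has exactly k classes:
-- there is a surjection onto Fin k whose fibres are exactly the R-classes
NumClasses : {m : ℕ} → (Fin m → Fin m → Set) → ℕ → Set
NumClasses {m} R k =
  Σ (Fin m → Fin k) λ q → Surjective _≡_ _≡_ q × (∀ x y → (q x ≡ q y → R x y) × (R x y → q x ≡ q y))

BidirDisconnected : Digraph → Set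
BidirDisconnected D =
  ∃ λ a → ∃ λ b → NumClasses (WeakConn D) a × NumClasses (θ D) b × a < b

-- θ-classes are represented by representatives: [x] → [y]
ClassTo : (D : Digraph) → Fin (n D) → Fin (n D) → Set
ClassTo D x y = ∃ λ s → ∃ λ t → θ D x s × θ D y t × Edge D s t

ClassAdj : (D : Digraph) → Fin (n D) → Fin (n D) → Set
ClassAdj D x y = ClassTo D x y ⊎ ClassTo D y x

ClassBi : (D : Digraph) → Fin (n D) → Fin (n D) → Set
ClassBi D x y = ClassTo D x y × ClassTo D y x

BackAndForth : Digraph → Set
BackAndForth D = ∃ λ x → ∃ λ y → ¬ θ D x y × ClassBi D x y

-- Let a → b be an edge between distinct θ-classes with [b] → [a]. Then b ↛ a, so
-- a ↦ s, b ↦ t is a homomorphism of D[{a, b}] for every edge s → t; its extension g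
-- preserves θ and carries the edge of [b] → [a] to one of [t] → [s].
module Submission where

open import Defs
open import Data.Fin using (Fin; _≟_)
open import Data.Fin.Subset using (Subset; _∈_; _∪_; ⁅_⁆)
open import Data.Fin.Subset.Properties using (x∈⁅x⁆; x∈⁅y⁆⇒x≡y; x∈p∪q⁻; p⊆p∪q; q⊆p∪q)
open import Data.Bool using (if_then_else_)
open import Data.Product using (∃; _×_; _,_)
open import Data.Sum using (_⊎_; inj₁; inj₂)
open import Data.Empty using (⊥-elim)
open import Relation.Nullary using (¬_; does; yes; no)
open import Relation.Binary.PropositionalEquality using (_≡_; refl; sym; subst; subst₂)
open import Relation.Binary.Construct.Closure.ReflexiveTransitive using (ε; _◅_; _◅◅_; gmap; reverse)

module _ (D : Digraph) where

  private
    V : Set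
    V = Fin (n D)

  θ-sym : ∀ {x y} → θ D x y → θ D y x
  θ-sym = reverse (λ { (p , q) → q , p })

  θ-preserved-by-endo : ∀ {g} → IsEndo D g → ∀ {x y} → θ D x y → θ D (g x) (g y)
  θ-preserved-by-endo {g} endo = gmap g (λ { {u} {v} (p , q) → endo u v p , endo v u q })

  ClassTo-respects-θ : ∀ {x x′ y y′} → θ D x x′ → θ D y y′ → ClassTo D x′ y′ → ClassTo D x y
  ClassTo-respects-θ x∼x′ y∼y′ (s , t , x′∼s , y′∼t , s→t) = s , t , x∼x′ ◅◅ x′∼s , y∼y′ ◅◅ y′∼t , s→t

  ClassTo-preserved-by-endo : ∀ {g} → IsEndo D g → ∀ {x y} → ClassTo D x y → ClassTo D (g x) (g y)
  ClassTo-preserved-by-endo endo (s , t , x∼s , y∼t , s→t) =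
    _ , _ , θ-preserved-by-endo endo x∼s , θ-preserved-by-endo endo y∼t , endo s t s→t

  ClassTo-between-classes⇒edge : ∀ {x y} → ¬ θ D x y → ClassTo D x y →
    ∃ λ a → ∃ λ b → θ D x a × θ D y b × Edge D a b × ¬ Edge D b a
  ClassTo-between-classes⇒edge x≁y (a , b , x∼a , y∼b , a→b) =
    a , b , x∼a , y∼b , a→b , λ b→a → x≁y (x∼a ◅◅ (a→b , b→a) ◅ θ-sym y∼b)

  pairMap : V → V → V → V → V
  pairMap a s t z = if does (z ≟ a) then s else t

  pairMap-at-first : ∀ a s t → pairMap a s t a ≡ s
  pairMap-at-first a s t with a ≟ a
  ... | yes _ = refl
  ... | no a≢a = ⊥-elim (a≢a refl)

  pairMap-at-second : ∀ {a b} s t → ¬ b ≡ a → pairMap a s t b ≡ t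
  pairMap-at-second {a} {b} s t b≢a with b ≟ a
  ... | yes b≡a = ⊥-elim (b≢a b≡a)
  ... | no _ = refl

  ∈-pair : ∀ {a b z : V} → z ∈ ⁅ a ⁆ ∪ ⁅ b ⁆ → z ≡ a ⊎ z ≡ b
  ∈-pair {a} {b} z∈ with x∈p∪q⁻ ⁅ a ⁆ ⁅ b ⁆ z∈
  ... | inj₁ z∈a = inj₁ (x∈⁅y⁆⇒x≡y a z∈a)
  ... | inj₂ z∈b = inj₂ (x∈⁅y⁆⇒x≡y b z∈b)

  first∈pair : ∀ (a b : V) → a ∈ ⁅ a ⁆ ∪ ⁅ b ⁆
  first∈pair a b = p⊆p∪q ⁅ b ⁆ (x∈⁅x⁆ a)

  second∈pair : ∀ (a b : V) → b ∈ ⁅ a ⁆ ∪ ⁅ b ⁆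
  second∈pair a b = q⊆p∪q ⁅ a ⁆ ⁅ b ⁆ (x∈⁅x⁆ b)

  -- Loops at a and b go to the loop at s or t, which is why reflexivity is needed.
  edge-extends-to-endo : HomHomogeneous D → Reflexive D →
    ∀ {a b s t} → ¬ Edge D b a → Edge D s t →
    ∃ λ g → IsEndo D g × g a ≡ s × g b ≡ t
  edge-extends-to-endo hh refl-D {a} {b} {s} {t} b↛a s→t =
    let g , endo , g≗f = hh (⁅ a ⁆ ∪ ⁅ b ⁆) (⁅ s ⁆ ∪ ⁅ t ⁆) (a , first∈pair a b) (s , first∈pair s t)
                            f (maps-into , preserves-edges)
    in g , endo , subst (g a ≡_) fa≡s (g≗f a (first∈pair a b)) , subst (g b ≡_) fb≡t (g≗f b (second∈pair a b))
    where
    b≢a : ¬ b ≡ a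
    b≢a refl = b↛a (refl-D a)

    f : V → V
    f = pairMap a s t

    fa≡s : f a ≡ s
    fa≡s = pairMap-at-first a s t

    fb≡t : f b ≡ t
    fb≡t = pairMap-at-second s t b≢a

    maps-into : ∀ z → z ∈ ⁅ a ⁆ ∪ ⁅ b ⁆ → f z ∈ ⁅ s ⁆ ∪ ⁅ t ⁆
    maps-into z z∈ with ∈-pair z∈
    ... | inj₁ refl = subst (_∈ ⁅ s ⁆ ∪ ⁅ t ⁆) (sym fa≡s) (first∈pair s t)
    ... | inj₂ refl = subst (_∈ ⁅ s ⁆ ∪ ⁅ t ⁆) (sym fb≡t) (second∈pair s t)

    preserves-edges : ∀ u v → u ∈ ⁅ a ⁆ ∪ ⁅ b ⁆ → v ∈ ⁅ a ⁆ ∪ ⁅ b ⁆ → Edge D u v → Edge D (f u) (f v)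
    preserves-edges u v u∈ v∈ u→v with ∈-pair u∈ | ∈-pair v∈
    ... | inj₁ refl | inj₁ refl = refl-D (f u)
    ... | inj₂ refl | inj₂ refl = refl-D (f u)
    ... | inj₁ refl | inj₂ refl = subst₂ (Edge D) (sym fa≡s) (sym fb≡t) s→t
    ... | inj₂ refl | inj₁ refl = ⊥-elim (b↛a u→v)

  ClassTo-sym : HomHomogeneous D → Reflexive D → BackAndForth D →
    ∀ {x y} → ClassTo D x y → ClassTo D y x
  ClassTo-sym hh refl-D (p , q , p≁q , p⇉q , q⇉p) {x} {y} (s , t , x∼s , y∼t , s→t)
    with ClassTo-between-classes⇒edge p≁q p⇉q
  ... | a , b , p∼a , q∼b , _ , b↛a
    with edge-extends-to-endo hh refl-D b↛a s→t
  ... | g , endo , refl , refl =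
    ClassTo-respects-θ
      (y∼t ◅◅ θ-preserved-by-endo endo (θ-sym q∼b))
      (x∼s ◅◅ θ-preserved-by-endo endo (θ-sym p∼a))
      (ClassTo-preserved-by-endo endo q⇉p)

lemma5p7 : (D : Digraph) → HomHomogeneous D → Reflexive D → BidirDisconnected D →
    Improper D → BackAndForth D →
    ∀ x y → ClassAdj D x y → ClassBi D x y
lemma5p7 D hh refl-D _ _ bf x y (inj₁ x⇉y) = x⇉y , ClassTo-sym D hh refl-D bf x⇉y
lemma5p7 D hh refl-D _ _ bf x y (inj₂ y⇉x) = ClassTo-sym D hh refl-D bf y⇉x , y⇉x
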